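{- Let $(\Gamma,\psi)$ be a divisible $H$-type asymptotic couple with asymptotic integration. For every $q\in\mathbb{Q}^{>0}$ and every $\alpha\in\Gamma$ with $|\alpha|>(1+q)|s0|$, we have $s(\alpha)=\psi(\alpha)$.
   Context: An asymptotic couple is $(\Gamma,\psi)$ with $\Gamma$ an ordered abelian group and $\psi:\Gamma\setminus\{0\}\to\Gamma$ satisfying (AC1) $\alpha+\beta\ne0\Rightarrow\psi(\alpha+\beta)\ge\min(\psi\alpha,\psi\beta)$, (AC2) $\psi(r\alpha)=\psi\alpha$ for $r\in\mathbb{Z}\setminus\{0\}$, (AC3) $\alpha>0\Rightarrow\alpha+\psi\alpha>\psi\beta$ (for $\alpha,\beta\ne0$). $H$-type: $0<\alpha\le\beta\Rightarrow\psi\alpha\ge\psi\beta$. Put $\psi(0)=\infty$ and $\gamma'=\gamma+\psi(\gamma)$ for $\gamma\ne0$. Asymptotic integration: every $\alpha\in\Gamma$ equals $\beta'$ for some $\beta\ne0$ (unique), denoted $\int\alpha$; the successor function is $s(\alpha):=\psi(\int\alpha)$; $s0$ is $s$ applied to $0$. -}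

module Defs where

open import Data.Nat as ℕ using (ℕ; zero; suc)
open import Data.Integer as ℤ using (ℤ; +_; -[1+_])
open import Data.Product using (Σ; _×_; _,_; proj₁; ∃)
open import Data.Sum using (_⊎_)
open import Relation.Binary.PropositionalEquality using (_≡_; _≢_)
open import Relation.Binary.Definitions using (tri<; tri≈; tri>)
open import Relation.Binary.Structures using (IsStrictTotalOrder)

record OrderedAbelianGroup : Set₁ where
  infixl 6 _+_
  infix 4 _<_
  field
    Carrier   : Set
    _+_       : Carrier → Carrier → Carrier
    0#        : Carrier
    -_        : Carrier → Carrier
    _<_       : Carrier → Carrier → Set
    +-assoc   : ∀ a b c → (a + b) + c ≡ a + (b + c)
    +-comm    : ∀ a b → a + b ≡ b + a
    +-identityˡ : ∀ a → 0# + a ≡ a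
    -‿inverseˡ : ∀ a → (- a) + a ≡ 0#
    isStrictTotalOrder : IsStrictTotalOrder _≡_ _<_
    +-mono-<  : ∀ {a b} c → a < b → a + c < b + c

  open IsStrictTotalOrder isStrictTotalOrder public using (compare)

  infix 4 _≤_
  _≤_ : Carrier → Carrier → Set
  a ≤ b = a < b ⊎ a ≡ b

  min : Carrier → Carrier → Carrier
  min a b with compare a b
  ... | tri< _ _ _ = a
  ... | tri≈ _ _ _ = a
  ... | tri> _ _ _ = b

  ∣_∣ : Carrier → Carrier
  ∣ a ∣ with compare 0# a
  ... | tri< _ _ _ = a
  ... | tri≈ _ _ _ = a
  ... | tri> _ _ _ = - a

  _·ℕ_ : ℕ → Carrier → Carrier
  zero ·ℕ a = 0#
  suc n ·ℕ a = a + (n ·ℕ a)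

  _·_ : ℤ → Carrier → Carrier
  (+ n) · a = n ·ℕ a
  -[1+ n ] · a = - (suc n ·ℕ a)

  Divisible : Set
  Divisible = ∀ (n : ℕ) → n ≢ 0 → ∀ a → ∃ λ b → n ·ℕ b ≡ a

-- An asymptotic couple (Γ, ψ). ψ is given as a total function on Γ whose value at 0
-- is irrelevant (all axioms only concern nonzero arguments; ψ(0) = ∞ by convention).
record AsymptoticCouple (Γ : OrderedAbelianGroup) : Set₁ where
  open OrderedAbelianGroup Γ
  field
    ψ   : Carrier → Carrier
    AC1 : ∀ α β → α ≢ 0# → β ≢ 0# → α + β ≢ 0# → min (ψ α) (ψ β) ≤ ψ (α + β)
    AC2 : ∀ (r : ℤ) α → r ≢ + 0 → α ≢ 0# → ψ (r · α) ≡ ψ α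
    AC3 : ∀ α β → α ≢ 0# → β ≢ 0# → 0# < α → ψ β < α + ψ α

  _′ : Carrier → Carrier
  γ ′ = γ + ψ γ

  HType : Set
  HType = ∀ α β → 0# < α → α ≤ β → ψ β ≤ ψ α

  HasAsymptoticIntegration : Set
  HasAsymptoticIntegration = ∀ α → Σ Carrier λ β → β ≢ 0# × β ′ ≡ α

  module _ (ai : HasAsymptoticIntegration) where
    ∫ : Carrier → Carrier
    ∫ α = proj₁ (ai α)

    s : Carrier → Carrier
    s α = ψ (∫ α)

module Submission where

-- Let β = ∫ α and e = ∫ 0, so that s α = ψ β, s0 = ψ e and e = - s0. As Γ is divisible and
-- ψ (γ / k) = ψ γ by AC2, AC3 at e / k and β / k bounds k (ψ β - ψ e) by |e| and k (ψ e - ψ β)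
-- by |β|: the difference ψ β - ψ e is negligible against |β| + |s0|. Hence
-- α = β + ψ β = β + s0 + (ψ β - ψ e), and |α| > (1 + q) |s0| forces β to be non-negligible
-- against s0. So α and β lie in the same archimedean class, on which ψ is constant in an
-- H-type couple.

open import Defs
open import Data.Integer as ℤ using (ℤ)
open import Data.Rational as ℚ using (ℚ; ↥_; ↧_; Positive)
open import Relation.Binary.PropositionalEquality using (_≡_)

open import Data.Nat as ℕ using (ℕ; zero; suc; z≤n; s≤s; z<s)
open import Data.Nat.Properties using (m<m+n; n≤1+n)
open import Data.Product using (∃; _×_; _,_; proj₁; proj₂)
open import Data.Sum using (_⊎_; inj₁; inj₂)
open import Relation.Nullary using (¬_; contradiction)
open import Relation.Binary.PropositionalEquality
  using (_≢_; refl; sym; trans; cong; cong₂; subst; subst₂; isEquivalence)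
open import Relation.Binary.Bundles using (StrictTotalOrder)
open import Relation.Binary.Structures using (IsStrictTotalOrder)
open import Relation.Binary.Definitions using (tri<; tri≈; tri>)
open import Algebra.Bundles using (AbelianGroup)
import Algebra.Properties.AbelianGroup as AbelianGroupProperties
import Algebra.Properties.CommutativeMonoid.Mult as CommutativeMonoidMult
import Algebra.Solver.CommutativeMonoid as CommutativeMonoidSolver
import Relation.Binary.Construct.StrictToNonStrict as StrictToNonStrict
import Relation.Binary.Reasoning.StrictPartialOrder as StrictReasoning

module OrderedAbelianGroupProperties (G : OrderedAbelianGroup) where
  open OrderedAbelianGroup G
  open IsStrictTotalOrder isStrictTotalOrder using (irrefl) renaming (trans to <-trans)

  abelianGroup : AbelianGroup _ _
  abelianGroup = record
    { Carrier = Carrier ; _≈_ = _≡_ ; _∙_ = _+_ ; ε = 0# ; _⁻¹ = -_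
    ; isAbelianGroup = record
      { isGroup = record
        { isMonoid = record
          { isSemigroup = record
            { isMagma = record { isEquivalence = isEquivalence ; ∙-cong = cong₂ _+_ }
            ; assoc = +-assoc }
          ; identity = +-identityˡ , λ a → trans (+-comm a 0#) (+-identityˡ a) }
        ; inverse = -‿inverseˡ , λ a → trans (+-comm a (- a)) (-‿inverseˡ a)
        ; ⁻¹-cong = cong -_ }
      ; comm = +-comm } }

  strictTotalOrder : StrictTotalOrder _ _ _
  strictTotalOrder = record { isStrictTotalOrder = isStrictTotalOrder }

  open AbelianGroup abelianGroup using (commutativeMonoid)
  open AbelianGroup abelianGroup public using (identityʳ)
  open AbelianGroupProperties abelianGroup public
    using ( ε⁻¹≈ε; ⁻¹-involutive; ⁻¹-∙-comm; ⁻¹-anti-homo‿-; inverseˡ-unique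
          ; \\-leftDividesˡ; //-rightDividesˡ; //-rightDividesʳ )
  open CommutativeMonoidMult commutativeMonoid using (×-homo-+; ×-distrib-+)
    renaming (_×_ to _×ᴹ_)
  open CommutativeMonoidSolver commutativeMonoid using (solve; _⊜_; _⊕_; id)
  open StrictReasoning (StrictTotalOrder.strictPartialOrder strictTotalOrder)

  infixl 6 _-_
  _-_ : Carrier → Carrier → Carrier
  a - b = a + - b

  ≤-antisym : ∀ {a b} → a ≤ b → b ≤ a → a ≡ b
  ≤-antisym = StrictToNonStrict.antisym _≡_ _<_ isEquivalence <-trans irrefl

  +-monoˡ-< : ∀ {a b} c → a < b → c + a < c + b
  +-monoˡ-< {a} {b} c a<b = subst₂ _<_ (+-comm a c) (+-comm b c) (+-mono-< c a<b)

  +-monoʳ-≤ : ∀ {a b} c → a ≤ b → a + c ≤ b + c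
  +-monoʳ-≤ c (inj₁ a<b) = inj₁ (+-mono-< c a<b)
  +-monoʳ-≤ c (inj₂ refl) = inj₂ refl

  +-monoˡ-≤ : ∀ {a b} c → a ≤ b → c + a ≤ c + b
  +-monoˡ-≤ c (inj₁ a<b) = inj₁ (+-monoˡ-< c a<b)
  +-monoˡ-≤ c (inj₂ refl) = inj₂ refl

  +-mono-≤ : ∀ {a b c d} → a ≤ b → c ≤ d → a + c ≤ b + d
  +-mono-≤ {a} {b} {c} {d} a≤b c≤d = begin
    a + c ≤⟨ +-monoʳ-≤ c a≤b ⟩
    b + c ≤⟨ +-monoˡ-≤ b c≤d ⟩
    b + d ∎

  +-mono-<-≤ : ∀ {a b c d} → a < b → c ≤ d → a + c < b + d
  +-mono-<-≤ {a} {b} {c} {d} a<b c≤d = begin-strict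
    a + c <⟨ +-mono-< c a<b ⟩
    b + c ≤⟨ +-monoˡ-≤ b c≤d ⟩
    b + d ∎

  +-mono-≤-< : ∀ {a b c d} → a ≤ b → c < d → a + c < b + d
  +-mono-≤-< {a} {b} {c} {d} a≤b c<d = begin-strict
    a + c ≤⟨ +-monoʳ-≤ c a≤b ⟩
    b + c <⟨ +-monoˡ-< b c<d ⟩
    b + d ∎

  +-cancelʳ-< : ∀ {a b} c → a + c < b + c → a < b
  +-cancelʳ-< {a} {b} c ac<bc =
    subst₂ _<_ (//-rightDividesʳ c a) (//-rightDividesʳ c b) (+-mono-< (- c) ac<bc)

  <-+nonnegʳ : ∀ {a b c} → a < b → 0# ≤ c → a < b + c
  <-+nonnegʳ {a} a<b 0≤c = subst (_< _) (identityʳ a) (+-mono-<-≤ a<b 0≤c)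

  <-+nonnegˡ : ∀ {a b c} → 0# ≤ c → a < b → a < c + b
  <-+nonnegˡ {a} 0≤c a<b = subst (_< _) (+-identityˡ a) (+-mono-≤-< 0≤c a<b)

  neg-anti-< : ∀ {a b} → a < b → - b < - a
  neg-anti-< {a} {b} a<b = subst₂ _<_ a+[-a-b]≡-b b+[-a-b]≡-a (+-mono-< (- a - b) a<b)
    where
    a+[-a-b]≡-b : a + (- a - b) ≡ - b
    a+[-a-b]≡-b = \\-leftDividesˡ a (- b)
    b+[-a-b]≡-a : b + (- a - b) ≡ - a
    b+[-a-b]≡-a = trans (cong (b +_) (+-comm (- a) (- b))) (\\-leftDividesˡ b (- a))

  neg<0⇒0<- : ∀ {a} → a < 0# → 0# < - a
  neg<0⇒0<- a<0 = subst (_< _) ε⁻¹≈ε (neg-anti-< a<0)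

  ∣∣-cases : ∀ a → (0# ≤ a × ∣ a ∣ ≡ a) ⊎ (a < 0# × ∣ a ∣ ≡ - a)
  ∣∣-cases a with compare 0# a
  ... | tri< 0<a _ _ = inj₁ (inj₁ 0<a , refl)
  ... | tri≈ _ 0≡a _ = inj₁ (inj₂ 0≡a , refl)
  ... | tri> _ _ a<0 = inj₂ (a<0 , refl)

  ∣∣-nonneg : ∀ a → 0# ≤ ∣ a ∣
  ∣∣-nonneg a with ∣∣-cases a
  ... | inj₁ (0≤a , ∣a∣≡a) = subst (0# ≤_) (sym ∣a∣≡a) 0≤a
  ... | inj₂ (a<0 , ∣a∣≡-a) = subst (0# ≤_) (sym ∣a∣≡-a) (inj₁ (neg<0⇒0<- a<0))

  ∣∣-pos : ∀ {a} → a ≢ 0# → 0# < ∣ a ∣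
  ∣∣-pos {a} a≢0 with ∣∣-cases a
  ... | inj₁ (inj₁ 0<a , ∣a∣≡a) = subst (0# <_) (sym ∣a∣≡a) 0<a
  ... | inj₁ (inj₂ 0≡a , _) = contradiction (sym 0≡a) a≢0
  ... | inj₂ (a<0 , ∣a∣≡-a) = subst (0# <_) (sym ∣a∣≡-a) (neg<0⇒0<- a<0)

  ∣∣≮0 : ∀ a → ¬ ∣ a ∣ < 0#
  ∣∣≮0 a ∣a∣<0 = irrefl refl (begin-strict 0# ≤⟨ ∣∣-nonneg a ⟩ ∣ a ∣ <⟨ ∣a∣<0 ⟩ 0# ∎)

  ∣∣≢0 : ∀ {a} → a ≢ 0# → ∣ a ∣ ≢ 0#
  ∣∣≢0 a≢0 ∣a∣≡0 = irrefl (sym ∣a∣≡0) (∣∣-pos a≢0)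

  0<∣∣⇒≢0 : ∀ {a} → 0# < ∣ a ∣ → a ≢ 0#
  0<∣∣⇒≢0 {a} 0<∣a∣ refl with ∣∣-cases 0#
  ... | inj₁ (_ , ∣0∣≡0) = irrefl (sym ∣0∣≡0) 0<∣a∣
  ... | inj₂ (0<0 , _) = irrefl refl 0<0

  ≤∣∣ : ∀ a → a ≤ ∣ a ∣
  ≤∣∣ a with ∣∣-cases a
  ... | inj₁ (_ , ∣a∣≡a) = inj₂ (sym ∣a∣≡a)
  ... | inj₂ (a<0 , ∣a∣≡-a) = subst (a ≤_) (sym ∣a∣≡-a) (inj₁ (<-trans a<0 (neg<0⇒0<- a<0)))

  -≤∣∣ : ∀ a → - a ≤ ∣ a ∣
  -≤∣∣ a with ∣∣-cases a
  ... | inj₁ (inj₁ 0<a , ∣a∣≡a) =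
    subst (- a ≤_) (sym ∣a∣≡a) (inj₁ (<-trans (subst (- a <_) ε⁻¹≈ε (neg-anti-< 0<a)) 0<a))
  ... | inj₁ (inj₂ refl , ∣0∣≡0) = inj₂ (trans ε⁻¹≈ε (sym ∣0∣≡0))
  ... | inj₂ (_ , ∣a∣≡-a) = inj₂ (sym ∣a∣≡-a)

  ∣∣-lub : ∀ {a b} → a ≤ b → - a ≤ b → ∣ a ∣ ≤ b
  ∣∣-lub {a} a≤b -a≤b with ∣∣-cases a
  ... | inj₁ (_ , ∣a∣≡a) = subst (_≤ _) (sym ∣a∣≡a) a≤b
  ... | inj₂ (_ , ∣a∣≡-a) = subst (_≤ _) (sym ∣a∣≡-a) -a≤b

  ∣-‿∣ : ∀ a → ∣ - a ∣ ≡ ∣ a ∣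
  ∣-‿∣ a = ≤-antisym
    (∣∣-lub (-≤∣∣ a) (subst (_≤ ∣ a ∣) (sym (⁻¹-involutive a)) (≤∣∣ a)))
    (∣∣-lub (subst (_≤ ∣ - a ∣) (⁻¹-involutive a) (-≤∣∣ (- a))) (≤∣∣ (- a)))

  ∣+∣≤ : ∀ a b → ∣ a + b ∣ ≤ ∣ a ∣ + ∣ b ∣
  ∣+∣≤ a b = ∣∣-lub (+-mono-≤ (≤∣∣ a) (≤∣∣ b))
    (subst (_≤ ∣ a ∣ + ∣ b ∣) (⁻¹-∙-comm a b) (+-mono-≤ (-≤∣∣ a) (-≤∣∣ b)))

  ·ℕ≗× : ∀ n a → n ·ℕ a ≡ n ×ᴹ a
  ·ℕ≗× zero a = refl
  ·ℕ≗× (suc n) a = cong (a +_) (·ℕ≗× n a)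

  ·-distribʳ-+ : ∀ m n a → (m ℕ.+ n) ·ℕ a ≡ m ·ℕ a + n ·ℕ a
  ·-distribʳ-+ m n a rewrite ·ℕ≗× (m ℕ.+ n) a | ·ℕ≗× m a | ·ℕ≗× n a = ×-homo-+ a m n

  ·-distribˡ-+ : ∀ n a b → n ·ℕ (a + b) ≡ n ·ℕ a + n ·ℕ b
  ·-distribˡ-+ n a b rewrite ·ℕ≗× n (a + b) | ·ℕ≗× n a | ·ℕ≗× n b = ×-distrib-+ a b n

  ·-zeroʳ : ∀ n → n ·ℕ 0# ≡ 0#
  ·-zeroʳ zero = refl
  ·-zeroʳ (suc n) = trans (+-identityˡ (n ·ℕ 0#)) (·-zeroʳ n)

  ·-neg : ∀ n a → n ·ℕ (- a) ≡ - (n ·ℕ a)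
  ·-neg zero a = sym ε⁻¹≈ε
  ·-neg (suc n) a = trans (cong (- a +_) (·-neg n a)) (⁻¹-∙-comm a (n ·ℕ a))

  ·-distribˡ-‿- : ∀ n a b → n ·ℕ (a - b) ≡ n ·ℕ a - n ·ℕ b
  ·-distribˡ-‿- n a b = trans (·-distribˡ-+ n a (- b)) (cong (n ·ℕ a +_) (·-neg n b))

  ·-monoʳ-≤ : ∀ n {a b} → a ≤ b → n ·ℕ a ≤ n ·ℕ b
  ·-monoʳ-≤ zero a≤b = inj₂ refl
  ·-monoʳ-≤ (suc n) a≤b = +-mono-≤ a≤b (·-monoʳ-≤ n a≤b)

  ·-monoʳ-< : ∀ n {a b} → a < b → suc n ·ℕ a < suc n ·ℕ b
  ·-monoʳ-< n a<b = +-mono-<-≤ a<b (·-monoʳ-≤ n (inj₁ a<b))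

  ·-nonneg : ∀ n {a} → 0# ≤ a → 0# ≤ n ·ℕ a
  ·-nonneg n {a} 0≤a = subst (_≤ n ·ℕ a) (·-zeroʳ n) (·-monoʳ-≤ n 0≤a)

  ·-monoˡ-≤ : ∀ {m n a} → m ℕ.≤ n → 0# ≤ a → m ·ℕ a ≤ n ·ℕ a
  ·-monoˡ-≤ {n = n} z≤n 0≤a = ·-nonneg n 0≤a
  ·-monoˡ-≤ {a = a} (s≤s m≤n) 0≤a = +-monoˡ-≤ a (·-monoˡ-≤ m≤n 0≤a)

  ·-cancelˡ-< : ∀ n {a b} → n ·ℕ a < n ·ℕ b → a < b
  ·-cancelˡ-< n {a} {b} na<nb with compare a b
  ... | tri< a<b _ _ = a<b
  ... | tri≈ _ refl _ = contradiction na<nb (irrefl refl)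
  ... | tri> _ _ b<a = contradiction (begin-strict
    n ·ℕ a <⟨ na<nb ⟩
    n ·ℕ b ≤⟨ ·-monoʳ-≤ n (inj₁ b<a) ⟩
    n ·ℕ a ∎) (irrefl refl)

  ·-∣∣≤ : ∀ n a → n ·ℕ ∣ a ∣ ≤ ∣ n ·ℕ a ∣
  ·-∣∣≤ n a with ∣∣-cases a
  ... | inj₁ (_ , ∣a∣≡a) = subst (λ z → n ·ℕ z ≤ ∣ n ·ℕ a ∣) (sym ∣a∣≡a) (≤∣∣ (n ·ℕ a))
  ... | inj₂ (_ , ∣a∣≡-a) = subst₂ (λ z w → n ·ℕ z ≤ w) (sym ∣a∣≡-a) (∣-‿∣ (n ·ℕ a))
                              (subst (_≤ ∣ - (n ·ℕ a) ∣) (sym (·-neg n a)) (≤∣∣ (- (n ·ℕ a))))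

  infix 4 _≼_
  _≼_ : Carrier → Carrier → Set
  a ≼ b = ∃ λ m → ∣ a ∣ < m ·ℕ ∣ b ∣

  module Perturbation {x y c t : Carrier} (D : ℕ)
           (x≡y+c+t : x ≡ y + (c + t))
           (t-negligible : ∀ k → k ·ℕ ∣ t ∣ < ∣ y ∣ + ∣ c ∣)
           (x-far : suc D ·ℕ ∣ c ∣ < D ·ℕ ∣ x ∣) where

    private
      X Y a T : Carrier
      X = ∣ x ∣
      Y = ∣ y ∣
      a = ∣ c ∣
      T = ∣ t ∣
      m : ℕ
      m = D ℕ.+ D

    ∣x∣≤ : X ≤ Y + (a + T)
    ∣x∣≤ = begin
      X               ≡⟨ cong ∣_∣ x≡y+c+t ⟩
      ∣ y + (c + t) ∣ ≤⟨ ∣+∣≤ y (c + t) ⟩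
      Y + ∣ c + t ∣   ≤⟨ +-monoˡ-≤ Y (∣+∣≤ c t) ⟩
      Y + (a + T)     ∎

    ∣y∣≤ : Y ≤ X + (a + T)
    ∣y∣≤ = begin
      Y                  ≡⟨ cong ∣_∣ y≡x-[c+t] ⟩
      ∣ x - (c + t) ∣    ≤⟨ ∣+∣≤ x (- (c + t)) ⟩
      X + ∣ - (c + t) ∣  ≡⟨ cong (X +_) (∣-‿∣ (c + t)) ⟩
      X + ∣ c + t ∣      ≤⟨ +-monoˡ-≤ X (∣+∣≤ c t) ⟩
      X + (a + T)        ∎
      where
      y≡x-[c+t] : y ≡ x - (c + t)
      y≡x-[c+t] = trans (sym (//-rightDividesʳ (c + t) y)) (cong (_- (c + t)) (sym x≡y+c+t))

    ∣c∣<∣x∣ : a < X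
    ∣c∣<∣x∣ = ·-cancelˡ-< D (begin-strict
      D ·ℕ a     ≤⟨ ·-monoˡ-≤ (n≤1+n D) (∣∣-nonneg c) ⟩
      suc D ·ℕ a <⟨ x-far ⟩
      D ·ℕ X     ∎)

    y≼x : y ≼ x
    y≼x = 5 , +-cancelʳ-< Y (begin-strict
      Y + Y                          ≤⟨ +-mono-≤ ∣y∣≤ ∣y∣≤ ⟩
      (X + (a + T)) + (X + (a + T))  ≡⟨ solve 3 (λ X a T →
                                          (X ⊕ (a ⊕ T)) ⊕ (X ⊕ (a ⊕ T))
                                        ⊜ (X ⊕ (X ⊕ (a ⊕ a))) ⊕ (T ⊕ (T ⊕ id))) refl X a T ⟩
      (X + (X + (a + a))) + 2 ·ℕ T   <⟨ +-monoˡ-< _ (t-negligible 2) ⟩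
      (X + (X + (a + a))) + (Y + a)  ≡⟨ solve 3 (λ X a Y →
                                          (X ⊕ (X ⊕ (a ⊕ a))) ⊕ (Y ⊕ a)
                                        ⊜ ((X ⊕ X) ⊕ (a ⊕ (a ⊕ (a ⊕ id)))) ⊕ Y) refl X a Y ⟩
      ((X + X) + 3 ·ℕ a) + Y         <⟨ +-mono-< Y (+-monoˡ-< (X + X) (·-monoʳ-< 2 ∣c∣<∣x∣)) ⟩
      ((X + X) + 3 ·ℕ X) + Y         ≡⟨ cong (_+ Y) (solve 1 (λ X →
                                          (X ⊕ X) ⊕ (X ⊕ (X ⊕ (X ⊕ id)))
                                        ⊜ X ⊕ (X ⊕ (X ⊕ (X ⊕ (X ⊕ id))))) refl X) ⟩
      5 ·ℕ X + Y                     ∎)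

    -- t is scaled by 2D rather than D so that the margin |c| / D granted by x-far survives.
    ∣c∣<∣y∣-multiple : a < suc m ·ℕ Y
    ∣c∣<∣y∣-multiple = +-cancelʳ-< (a + m ·ℕ a) (begin-strict
      a + (a + m ·ℕ a)             ≡⟨ cong (λ z → a + (a + z)) (·-distribʳ-+ D D a) ⟩
      a + (a + (D ·ℕ a + D ·ℕ a))  ≡⟨ solve 2 (λ a u → a ⊕ (a ⊕ (u ⊕ u)) ⊜ (a ⊕ u) ⊕ (a ⊕ u))
                                        refl a (D ·ℕ a) ⟩
      suc D ·ℕ a + suc D ·ℕ a      <⟨ +-mono-<-≤ x-far (inj₁ x-far) ⟩
      D ·ℕ X + D ·ℕ X              ≡⟨ ·-distribʳ-+ D D X ⟨
      m ·ℕ X                       ≤⟨ ·-monoʳ-≤ m ∣x∣≤ ⟩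
      m ·ℕ (Y + (a + T))           ≡⟨ trans (·-distribˡ-+ m Y (a + T))
                                        (cong (m ·ℕ Y +_) (·-distribˡ-+ m a T)) ⟩
      m ·ℕ Y + (m ·ℕ a + m ·ℕ T)   <⟨ +-monoˡ-< (m ·ℕ Y) (+-monoˡ-< (m ·ℕ a) (t-negligible m)) ⟩
      m ·ℕ Y + (m ·ℕ a + (Y + a))  ≡⟨ solve 4 (λ u v Y a → u ⊕ (v ⊕ (Y ⊕ a)) ⊜ (Y ⊕ u) ⊕ (a ⊕ v))
                                        refl (m ·ℕ Y) (m ·ℕ a) Y a ⟩
      suc m ·ℕ Y + (a + m ·ℕ a)    ∎)

    x≼y : x ≼ y
    x≼y = suc (suc (suc m ℕ.+ suc m)) , (begin-strict
      X                                    ≤⟨ ∣x∣≤ ⟩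
      Y + (a + T)                          <⟨ +-monoˡ-< Y (+-monoˡ-< a T<Y+a) ⟩
      Y + (a + (Y + a))                    ≡⟨ solve 2 (λ Y a → Y ⊕ (a ⊕ (Y ⊕ a)) ⊜ Y ⊕ (Y ⊕ (a ⊕ a)))
                                                refl Y a ⟩
      Y + (Y + (a + a))                    <⟨ +-monoˡ-< Y (+-monoˡ-< Y
                                                (+-mono-<-≤ ∣c∣<∣y∣-multiple (inj₁ ∣c∣<∣y∣-multiple))) ⟩
      Y + (Y + (suc m ·ℕ Y + suc m ·ℕ Y))  ≡⟨ cong (λ z → Y + (Y + z)) (·-distribʳ-+ (suc m) (suc m) Y) ⟨
      suc (suc (suc m ℕ.+ suc m)) ·ℕ Y     ∎)
      where
      T<Y+a : T < Y + a
      T<Y+a = subst (_< Y + a) (identityʳ T) (t-negligible 1)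

module AsymptoticCoupleProperties {G : OrderedAbelianGroup} (A : AsymptoticCouple G) where
  open OrderedAbelianGroup G
  open OrderedAbelianGroupProperties G
  open AsymptoticCouple A
  open StrictReasoning (StrictTotalOrder.strictPartialOrder strictTotalOrder)

  ψ-·ℕ : ∀ n {a} → a ≢ 0# → ψ (suc n ·ℕ a) ≡ ψ a
  ψ-·ℕ n {a} = AC2 (ℤ.+ suc n) a (λ ())

  ψ-neg : ∀ {a} → a ≢ 0# → ψ (- a) ≡ ψ a
  ψ-neg {a} a≢0 = trans (cong (λ z → ψ (- z)) (sym (identityʳ a))) (AC2 ℤ.-1ℤ a (λ ()) a≢0)

  ψ-∣∣ : ∀ {a} → a ≢ 0# → ψ ∣ a ∣ ≡ ψ a
  ψ-∣∣ {a} a≢0 with ∣∣-cases a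
  ... | inj₁ (_ , ∣a∣≡a) = cong ψ ∣a∣≡a
  ... | inj₂ (_ , ∣a∣≡-a) = trans (cong ψ ∣a∣≡-a) (ψ-neg a≢0)

  ψ<∣∣+ψ : ∀ {a b} → a ≢ 0# → b ≢ 0# → ψ a < ∣ b ∣ + ψ b
  ψ<∣∣+ψ {a} {b} a≢0 b≢0 =
    subst (λ z → ψ a < ∣ b ∣ + z) (ψ-∣∣ b≢0) (AC3 ∣ b ∣ a (∣∣≢0 b≢0) a≢0 (∣∣-pos b≢0))

  module _ (divisible : Divisible) where

    ·ψ<∣∣+·ψ : ∀ k {a b} → a ≢ 0# → b ≢ 0# → k ·ℕ ψ a < ∣ b ∣ + k ·ℕ ψ b
    ·ψ<∣∣+·ψ zero {b = b} _ b≢0 = subst (0# <_) (sym (identityʳ ∣ b ∣)) (∣∣-pos b≢0)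
    ·ψ<∣∣+·ψ (suc k) {a} {b} a≢0 b≢0 with divisible (suc k) (λ ()) b
    ... | b₁ , k·b₁≡b = begin-strict
      suc k ·ℕ ψ a                     <⟨ ·-monoʳ-< k (ψ<∣∣+ψ a≢0 b₁≢0) ⟩
      suc k ·ℕ (∣ b₁ ∣ + ψ b₁)         ≡⟨ ·-distribˡ-+ (suc k) ∣ b₁ ∣ (ψ b₁) ⟩
      suc k ·ℕ ∣ b₁ ∣ + suc k ·ℕ ψ b₁  ≤⟨ +-monoʳ-≤ (suc k ·ℕ ψ b₁) k·∣b₁∣≤∣b∣ ⟩
      ∣ b ∣ + suc k ·ℕ ψ b₁            ≡⟨ cong (λ z → ∣ b ∣ + suc k ·ℕ z) ψb₁≡ψb ⟩
      ∣ b ∣ + suc k ·ℕ ψ b             ∎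
      where
      b₁≢0 : b₁ ≢ 0#
      b₁≢0 refl = b≢0 (trans (sym k·b₁≡b) (·-zeroʳ (suc k)))
      ψb₁≡ψb : ψ b₁ ≡ ψ b
      ψb₁≡ψb = trans (sym (ψ-·ℕ k b₁≢0)) (cong ψ k·b₁≡b)
      k·∣b₁∣≤∣b∣ : suc k ·ℕ ∣ b₁ ∣ ≤ ∣ b ∣
      k·∣b₁∣≤∣b∣ = subst (λ z → suc k ·ℕ ∣ b₁ ∣ ≤ ∣ z ∣) k·b₁≡b (·-∣∣≤ (suc k) b₁)

    ·[ψ-ψ]<∣∣ : ∀ k {a b} → a ≢ 0# → b ≢ 0# → k ·ℕ (ψ a - ψ b) < ∣ b ∣
    ·[ψ-ψ]<∣∣ k {a} {b} a≢0 b≢0 = begin-strict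
      k ·ℕ (ψ a - ψ b)             ≡⟨ ·-distribˡ-‿- k (ψ a) (ψ b) ⟩
      k ·ℕ ψ a - k ·ℕ ψ b          <⟨ +-mono-< (- (k ·ℕ ψ b)) (·ψ<∣∣+·ψ k a≢0 b≢0) ⟩
      ∣ b ∣ + k ·ℕ ψ b - k ·ℕ ψ b  ≡⟨ //-rightDividesʳ (k ·ℕ ψ b) ∣ b ∣ ⟩
      ∣ b ∣                        ∎

    ·∣ψ-ψ∣<∣∣+∣∣ : ∀ k {a b} → a ≢ 0# → b ≢ 0# → k ·ℕ ∣ ψ a - ψ b ∣ < ∣ a ∣ + ∣ b ∣
    ·∣ψ-ψ∣<∣∣+∣∣ k {a} {b} a≢0 b≢0 with ∣∣-cases (ψ a - ψ b)
    ... | inj₁ (_ , ∣d∣≡d) = subst (λ z → k ·ℕ z < ∣ a ∣ + ∣ b ∣) (sym ∣d∣≡d)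
                               (<-+nonnegˡ (∣∣-nonneg a) (·[ψ-ψ]<∣∣ k a≢0 b≢0))
    ... | inj₂ (_ , ∣d∣≡-d) = subst (λ z → k ·ℕ z < ∣ a ∣ + ∣ b ∣)
                               (sym (trans ∣d∣≡-d (⁻¹-anti-homo‿- (ψ a) (ψ b))))
                               (<-+nonnegʳ (·[ψ-ψ]<∣∣ k b≢0 a≢0) (∣∣-nonneg b))

  module _ (htype : HType) where

    ψ-antitone-≼ : ∀ {a b} → a ≢ 0# → b ≢ 0# → a ≼ b → ψ b ≤ ψ a
    ψ-antitone-≼ {a} _ _ (zero , ∣a∣<0) = contradiction ∣a∣<0 (∣∣≮0 a)
    ψ-antitone-≼ {a} {b} a≢0 b≢0 (suc n , ∣a∣<n∣b∣) =
      subst₂ _≤_ (trans (ψ-·ℕ n (∣∣≢0 b≢0)) (ψ-∣∣ b≢0)) (ψ-∣∣ a≢0)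
        (htype ∣ a ∣ (suc n ·ℕ ∣ b ∣) (∣∣-pos a≢0) (inj₁ ∣a∣<n∣b∣))

  module _ (divisible : Divisible) (htype : HType) (ai : HasAsymptoticIntegration) where

    s≡ψ : ∀ D {α} → suc D ·ℕ ∣ s ai 0# ∣ < D ·ℕ ∣ α ∣ → s ai α ≡ ψ α
    s≡ψ D {α} α-far = ≤-antisym (ψ-antitone-≼ htype α≢0 β≢0 α≼β) (ψ-antitone-≼ htype β≢0 α≢0 β≼α)
      where
      β e : Carrier
      β = ∫ ai α
      e = ∫ ai 0#
      β≢0 : β ≢ 0#
      β≢0 = proj₁ (proj₂ (ai α))
      e≢0 : e ≢ 0#
      e≢0 = proj₁ (proj₂ (ai 0#))

      α≡β+ψe+[ψβ-ψe] : α ≡ β + (ψ e + (ψ β - ψ e))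
      α≡β+ψe+[ψβ-ψe] = begin-equality
        α                          ≡⟨ proj₂ (proj₂ (ai α)) ⟨
        β + ψ β                    ≡⟨ cong (β +_) (//-rightDividesˡ (ψ e) (ψ β)) ⟨
        β + (ψ β - ψ e + ψ e)      ≡⟨ cong (β +_) (+-comm (ψ β - ψ e) (ψ e)) ⟩
        β + (ψ e + (ψ β - ψ e))    ∎

      ∣e∣≡∣ψe∣ : ∣ e ∣ ≡ ∣ ψ e ∣
      ∣e∣≡∣ψe∣ = trans (cong ∣_∣ (inverseˡ-unique e (ψ e) (proj₂ (proj₂ (ai 0#))))) (∣-‿∣ (ψ e))

      ψβ-ψe-negligible : ∀ k → k ·ℕ ∣ ψ β - ψ e ∣ < ∣ β ∣ + ∣ ψ e ∣
      ψβ-ψe-negligible k =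
        subst (λ z → k ·ℕ ∣ ψ β - ψ e ∣ < ∣ β ∣ + z) ∣e∣≡∣ψe∣ (·∣ψ-ψ∣<∣∣+∣∣ divisible k β≢0 e≢0)

      open Perturbation D α≡β+ψe+[ψβ-ψe] ψβ-ψe-negligible α-far
        renaming (x≼y to α≼β; y≼x to β≼α; ∣c∣<∣x∣ to ∣ψe∣<∣α∣)

      α≢0 : α ≢ 0#
      α≢0 = 0<∣∣⇒≢0 (begin-strict 0# ≤⟨ ∣∣-nonneg (ψ e) ⟩ ∣ ψ e ∣ <⟨ ∣ψe∣<∣α∣ ⟩ ∣ α ∣ ∎)

corollary7p3 : (Γ : OrderedAbelianGroup) (A : AsymptoticCouple Γ) →
    OrderedAbelianGroup.Divisible Γ →
    AsymptoticCouple.HType A →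
    (ai : AsymptoticCouple.HasAsymptoticIntegration A) →
    (q : ℚ) → Positive q → (α : OrderedAbelianGroup.Carrier Γ) →
    OrderedAbelianGroup._<_ Γ
      (OrderedAbelianGroup._·_ Γ ((↧ q) ℤ.+ (↥ q))
        (OrderedAbelianGroup.∣_∣ Γ (AsymptoticCouple.s A ai (OrderedAbelianGroup.0# Γ))))
      (OrderedAbelianGroup._·_ Γ (↧ q) (OrderedAbelianGroup.∣_∣ Γ α)) →
    AsymptoticCouple.s A ai α ≡ AsymptoticCouple.ψ A α
corollary7p3 Γ A divisible htype ai (ℚ.mkℚ (ℤ.+ suc n) d _) _ α α-far =
  s≡ψ divisible htype ai (suc d) (begin-strict
    suc (suc d) ·ℕ ∣ s0 ∣       ≤⟨ ·-monoˡ-≤ (m<m+n (suc d) z<s) (∣∣-nonneg s0) ⟩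
    (suc d ℕ.+ suc n) ·ℕ ∣ s0 ∣ <⟨ α-far ⟩
    suc d ·ℕ ∣ α ∣              ∎)
  where
  open OrderedAbelianGroup Γ
  open OrderedAbelianGroupProperties Γ
  open AsymptoticCouple A using (s)
  open AsymptoticCoupleProperties A
  open StrictReasoning (StrictTotalOrder.strictPartialOrder strictTotalOrder)
  s0 : Carrier
  s0 = s ai 0#
corollary7p3 _ _ _ _ _ (ℚ.mkℚ (ℤ.+ zero) _ _) () _ _
corollary7p3 _ _ _ _ _ (ℚ.mkℚ ℤ.-[1+ _ ] _ _) () _ _
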